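{- Let $n>2$ be an integer, let $R(n,n)$ be the diagonal Ramsey number, and let $g(n)$ denote the maximum chromatic number of a graph on fewer than $R(n,n)$ vertices with clique number less than $n$. Then every graph $G$ with $\omega(G)<n$ and $|V(G)|\ge R(n,n)$ satisfies $$\chi(G)\le \left\lceil\frac{|V(G)|-R(n,n)+1}{n}\right\rceil+g(n).$$
   Context: All graphs are finite and simple; $\chi(G)$ is the chromatic number and $\omega(G)$ the clique number. $R(n,n)$ is the smallest integer $N$ such that every graph on $N$ vertices contains a clique of size $n$ or an independent set of size $n$. -}

module Defs where

open import Data.Nat using (ℕ; zero; suc; _+_; _∸_; _≤_; _<_)
open import Data.Nat.DivMod using (_/_)
open import Data.Fin using (Fin)
open import Data.Bool using (Bool; true; false)
open import Data.Product using (Σ; _×_; ∃)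
open import Data.Sum using (_⊎_)
open import Relation.Nullary using (¬_)
open import Relation.Binary.PropositionalEquality using (_≡_; _≢_)
open import Function.Definitions using (Injective)

record Graph (N : ℕ) : Set where
  field
    adj     : Fin N → Fin N → Bool
    adj-sym : ∀ i j → adj i j ≡ adj j i
    adj-irr : ∀ i → adj i i ≡ false
open Graph public

HasClique : ∀ {N} → Graph N → ℕ → Set
HasClique {N} G k =
  Σ (Fin k → Fin N) λ f → Injective _≡_ _≡_ f ×
    (∀ i j → i ≢ j → adj G (f i) (f j) ≡ true)

HasIndependent : ∀ {N} → Graph N → ℕ → Set
HasIndependent {N} G k =
  Σ (Fin k → Fin N) λ f → Injective _≡_ _≡_ f ×
    (∀ i j → i ≢ j → adj G (f i) (f j) ≡ false)

CliqueNumberLessThan : ∀ {N} → Graph N → ℕ → Set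
CliqueNumberLessThan G n = ¬ HasClique G n

Colourable : ∀ {N} → Graph N → ℕ → Set
Colourable {N} G k =
  Σ (Fin N → Fin k) λ c → ∀ i j → adj G i j ≡ true → c i ≢ c j

IsChromaticNumber : ∀ {N} → Graph N → ℕ → Set
IsChromaticNumber G k = Colourable G k × (∀ j → Colourable G j → k ≤ j)

RamseyProperty : ℕ → ℕ → Set
RamseyProperty n N = (G : Graph N) → HasClique G n ⊎ HasIndependent G n

IsDiagonalRamsey : ℕ → ℕ → Set
IsDiagonalRamsey n R = RamseyProperty n R × (∀ M → RamseyProperty n M → R ≤ M)

IsMaxChromaticBelow : ℕ → ℕ → ℕ → Set
IsMaxChromaticBelow n R g =
  (∃ λ M → M < R × Σ (Graph M) λ G →
      CliqueNumberLessThan G n × IsChromaticNumber G g)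
  × (∀ M → M < R → (G : Graph M) → CliqueNumberLessThan G n →
      ∀ c → IsChromaticNumber G c → c ≤ g)

-- ceiling division ⌈ a / n ⌉ (n = 0 gives 0, never used)
⌈_/_⌉ : ℕ → ℕ → ℕ
⌈ a / zero ⌉ = 0
⌈ a / suc m ⌉ = (a + m) / suc m

module Submission where

-- Let k = ⌈(N − R + 1)/n⌉, so that N < R + k n.  By induction on k, every
-- graph without an n-clique on fewer than R + k n vertices is (k + g)-colourable:
-- below R vertices this is the definition of g; otherwise, by Ramsey, any R of
-- the vertices contain an independent n-set, which becomes one new colour
-- class, and the remaining fewer than R + (k − 1) n vertices are coloured by
-- induction.

open import Defs
open import Data.Nat using (ℕ; zero; suc; _+_; _∸_; _*_; _≤_; _<_; _<?_; s≤s⁻¹)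
open import Data.Nat.Properties
  using (≮⇒≥; n<1+n; m≤n+m; +-comm; +-suc;
         +-cancelˡ-<; +-cancelʳ-≤; +-commutativeSemigroup; +-monoˡ-≤; +-monoʳ-≤; m+[n∸m]≡n; module ≤-Reasoning)
open import Algebra.Properties.CommutativeSemigroup +-commutativeSemigroup using (x∙yz≈y∙xz)
open import Data.Nat.DivMod using (_%_; m≡m%n+[m/n]*n; m%n<n)
open import Data.Fin as Fin
  using (Fin; zero; suc; toℕ; fromℕ; fromℕ<; inject; inject₁; inject≤; finToFun; funToFin; join; splitAt)
open import Data.Fin.Properties
  using (any?; all?; ¬∀⟶∃¬-smallest; toℕ-fromℕ; toℕ-fromℕ<; toℕ-inject;
         inject≤-injective; inject₁-injective; fromℕ≢inject₁; suc-injective;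
         finToFun-funToFin; injective⇒≤; join-splitAt)
open import Data.Vec.Functional using (_∷_)
open import Data.Bool using (true; false)
import Data.Bool as Bool
open import Data.Product using (∃; _×_; _,_; proj₁)
open import Data.Sum using (inj₁; inj₂; [_,_]′)
open import Data.Empty using (⊥; ⊥-elim)
open import Level using (0ℓ)
open import Relation.Nullary using (¬_; Dec; yes; no)
open import Relation.Nullary.Decidable using (_→-dec_; ¬?; decidable-stable)
open import Relation.Unary using (Pred; Decidable)
open import Relation.Binary.PropositionalEquality
  using (_≡_; _≢_; refl; sym; trans; cong; subst; _≗_)
open import Function using (_∘_; id)
open import Function.Definitions using (Injective)

induced : ∀ {N M} → Graph N → (Fin M → Fin N) → Graph M
induced G e = record
  { adj     = λ i j → adj G (e i) (e j)
  ; adj-sym = λ i j → adj-sym G (e i) (e j)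
  ; adj-irr = λ i → adj-irr G (e i)
  }

adj⇒≢ : ∀ {N} (G : Graph N) {u v} → adj G u v ≡ true → u ≢ v
adj⇒≢ G {u} uv refl with trans (sym uv) (adj-irr G u)
... | ()

-- e need not be injective: vertices of a clique are adjacent, hence have distinct images.
induced-noClique : ∀ {N M n} (G : Graph N) (e : Fin M → Fin N) →
  ¬ HasClique G n → ¬ HasClique (induced G e) n
induced-noClique G e noClique (f , f-injective , clique) =
  noClique (e ∘ f , e∘f-injective , clique)
  where
  e∘f-injective : Injective _≡_ _≡_ (e ∘ f)
  e∘f-injective {i} {j} eq with i Fin.≟ j
  ... | yes i≡j = i≡j
  ... | no i≢j  = ⊥-elim (adj⇒≢ G (clique i j i≢j) eq)

IsProperColouring : ∀ {M K} → Graph M → (Fin M → Fin K) → Set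
IsProperColouring H c = ∀ i j → adj H i j ≡ true → c i ≢ c j

isProperColouring-resp-≗ : ∀ {M K} (H : Graph M) {c d : Fin M → Fin K} →
  c ≗ d → IsProperColouring H c → IsProperColouring H d
isProperColouring-resp-≗ H c≗d proper i j ij di≡dj =
  proper i j ij (trans (c≗d i) (trans di≡dj (sym (c≗d j))))

isProperColouring? : ∀ {M K} (H : Graph M) (c : Fin M → Fin K) → Dec (IsProperColouring H c)
isProperColouring? H c =
  all? λ i → all? λ j → (adj H i j Bool.≟ true) →-dec ¬? (c i Fin.≟ c j)

-- Colourings Fin M → Fin K are enumerated by Fin (K ^ M).
colourable? : ∀ {M} (H : Graph M) K → Dec (Colourable H K)
colourable? H K with any? (isProperColouring? H ∘ finToFun)
... | yes (i , proper) = yes (finToFun i , proper)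
... | no ¬proper       = no λ (c , proper) →
  ¬proper (funToFin c , isProperColouring-resp-≗ H (sym ∘ finToFun-funToFin c) proper)

colourable-mono : ∀ {M} (H : Graph M) {a b} → a ≤ b → Colourable H a → Colourable H b
colourable-mono H a≤b (c , proper) =
  (λ i → inject≤ (c i) a≤b) ,
  λ i j ij eq → proper i j ij (inject≤-injective a≤b a≤b (c i) (c j) eq)

colourable-size : ∀ {M} (H : Graph M) → Colourable H M
colourable-size H = id , λ i j ij → adj⇒≢ H ij

least-satisfying : {P : ℕ → Set} → (∀ k → Dec (P k)) → ∀ m → P m →
  ∃ λ k → P k × (∀ j → P j → k ≤ j)
least-satisfying {P} P? m pm
  with ¬∀⟶∃¬-smallest (suc m) (¬_ ∘ P ∘ toℕ) (¬? ∘ P? ∘ toℕ)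
         (λ none → none (fromℕ m) (subst P (sym (toℕ-fromℕ m)) pm))
... | k , ¬¬pk , below =
  toℕ k , decidable-stable (P? (toℕ k)) ¬¬pk ,
  λ j pj → ≮⇒≥ λ j<k → below (fromℕ< j<k)
    (subst P (sym (trans (toℕ-inject (fromℕ< j<k)) (toℕ-fromℕ< j<k))) pj)

chromaticNumber-exists : ∀ {M} (H : Graph M) → ∃ (IsChromaticNumber H)
chromaticNumber-exists {M} H = least-satisfying (colourable? H) M (colourable-size H)

record Enumeration {M} (P : Pred (Fin M) 0ℓ) : Set where
  field
    size           : ℕ
    elem           : Fin size → Fin M
    elem-injective : Injective _≡_ _≡_ elem
    elem-sound     : ∀ w → P (elem w)
    elem-complete  : ∀ v → P v → ∃ λ w → elem w ≡ v

enumerate : ∀ {M} {P : Pred (Fin M) 0ℓ} → Decidable P → Enumeration P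
enumerate {zero} P? = record
  { size = 0 ; elem = λ () ; elem-injective = λ { {()} } ; elem-sound = λ () ; elem-complete = λ () }
enumerate {suc M} {P} P? with enumerate (P? ∘ suc) | P? zero
... | E | no ¬p0 = record
  { size           = size
  ; elem           = suc ∘ elem
  ; elem-injective = elem-injective ∘ suc-injective
  ; elem-sound     = elem-sound
  ; elem-complete  = complete
  }
  where
  open Enumeration E
  complete : ∀ v → P v → ∃ λ w → suc (elem w) ≡ v
  complete zero    p0 = ⊥-elim (¬p0 p0)
  complete (suc v) pv with elem-complete v pv
  ... | w , eq = w , cong suc eq
... | E | yes p0 = record
  { size           = suc size
  ; elem           = zero ∷ (suc ∘ elem)
  ; elem-injective = injective
  ; elem-sound     = sound
  ; elem-complete  = complete
  }
  where
  open Enumeration E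
  injective : Injective _≡_ _≡_ (zero ∷ (suc ∘ elem))
  injective {zero}  {zero}  _  = refl
  injective {suc w} {suc x} eq = cong suc (elem-injective (suc-injective eq))
  injective {zero}  {suc _} ()
  injective {suc _} {zero}  ()
  sound : ∀ w → P ((zero ∷ (suc ∘ elem)) w)
  sound zero    = p0
  sound (suc w) = elem-sound w
  complete : ∀ v → P v → ∃ λ w → (zero ∷ (suc ∘ elem)) w ≡ v
  complete zero    _  = zero , refl
  complete (suc v) pv with elem-complete v pv
  ... | w , eq = suc w , cong suc eq

[,]-injective : ∀ {a b M} {f : Fin a → Fin M} {h : Fin b → Fin M} →
  Injective _≡_ _≡_ f → Injective _≡_ _≡_ h → (∀ i w → f i ≢ h w) →
  Injective _≡_ _≡_ [ f , h ]′
[,]-injective f-inj h-inj disjoint {inj₁ i} {inj₁ j} eq = cong inj₁ (f-inj eq)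
[,]-injective f-inj h-inj disjoint {inj₁ i} {inj₂ w} eq = ⊥-elim (disjoint i w eq)
[,]-injective f-inj h-inj disjoint {inj₂ w} {inj₁ i} eq = ⊥-elim (disjoint i w (sym eq))
[,]-injective f-inj h-inj disjoint {inj₂ w} {inj₂ x} eq = cong inj₂ (h-inj eq)

disjoint-injections⇒+≤ : ∀ {a b M} {f : Fin a → Fin M} {h : Fin b → Fin M} →
  Injective _≡_ _≡_ f → Injective _≡_ _≡_ h → (∀ i w → f i ≢ h w) → a + b ≤ M
disjoint-injections⇒+≤ {a} {b} {f = f} {h} f-inj h-inj disjoint =
  injective⇒≤ {f = [ f , h ]′ ∘ splitAt a} λ {x} {y} eq →
    trans (sym (join-splitAt a b x))
      (trans (cong (join a b) ([,]-injective f-inj h-inj disjoint {splitAt a x} {splitAt a y} eq)) (join-splitAt a b y))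

Image : ∀ {n M} → (Fin n → Fin M) → Pred (Fin M) 0ℓ
Image f v = ∃ λ i → f i ≡ v

image? : ∀ {n M} (f : Fin n → Fin M) → Decidable (Image f)
image? f v = any? λ i → f i Fin.≟ v

colourable-addIndependent : ∀ {n M K} (H : Graph M) (f : Fin n → Fin M) →
  (∀ a b → a ≢ b → adj H (f a) (f b) ≡ false) →
  (E : Enumeration (¬_ ∘ Image f)) → Colourable (induced H (Enumeration.elem E)) K →
  Colourable H (suc K)
colourable-addIndependent {M = M} {K} H f independent E (c , proper) = colour , colour-proper
  where
  open Enumeration E
  colourBy : ∀ v → Dec (Image f v) → Fin (suc K)
  colourBy v (yes _)   = fromℕ K
  colourBy v (no ¬img) = inject₁ (c (proj₁ (elem-complete v ¬img)))
  colour : Fin M → Fin (suc K)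
  colour v = colourBy v (image? f v)
  inImage-nonadjacent : ∀ {i j} → adj H (f i) (f j) ≡ true → ⊥
  inImage-nonadjacent {i} {j} ij with i Fin.≟ j
  ... | yes refl = adj⇒≢ H ij refl
  ... | no i≢j with trans (sym ij) (independent i j i≢j)
  ... | ()
  colour-proper : IsProperColouring H colour
  colour-proper u v uv with image? f u | image? f v
  ... | yes (i , refl) | yes (j , refl) = λ _ → inImage-nonadjacent uv
  ... | yes _          | no _           = fromℕ≢inject₁
  ... | no _           | yes _          = fromℕ≢inject₁ ∘ sym
  ... | no ¬u          | no ¬v
    with elem-complete u ¬u | elem-complete v ¬v
  ... | w , refl | x , refl = proper w x uv ∘ inject₁-injective

induced-hasIndependent : ∀ {N M n} (H : Graph N) {e : Fin M → Fin N} →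
  Injective _≡_ _≡_ e → HasIndependent (induced H e) n → HasIndependent H n
induced-hasIndependent H e-injective (f , f-injective , independent) =
  _ , f-injective ∘ e-injective , independent

module _ {n R g N : ℕ} (ramsey : RamseyProperty n R) (G : Graph N) (noClique : ¬ HasClique G n)
         (colourable-small : ∀ {M} → M < R → (e : Fin M → Fin N) → Colourable (induced G e) g)
         where

  hasIndependent-large : ∀ {M} → R ≤ M → (e : Fin M → Fin N) → HasIndependent (induced G e) n
  hasIndependent-large R≤M e =
    [ ⊥-elim ∘ induced-noClique G (e ∘ ι) noClique
    , induced-hasIndependent (induced G e) (inject≤-injective R≤M R≤M _ _)
    ]′ (ramsey (induced G (e ∘ ι)))
    where
    ι : Fin _ → Fin _
    ι i = inject≤ i R≤M

  colourable-induced : ∀ k {M} → M < R + k * n → (e : Fin M → Fin N) →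
    Colourable (induced G e) (k + g)
  colourable-induced zero {M} M<R+0 e =
    colourable-small (subst (M <_) (+-comm R 0) M<R+0) e
  colourable-induced (suc k) {M} M<bound e with M <? R
  ... | yes M<R = colourable-mono (induced G e) (m≤n+m g (suc k)) (colourable-small M<R e)
  ... | no M≮R  with hasIndependent-large (≮⇒≥ M≮R) e
  ...   | f , f-injective , independent =
    colourable-addIndependent (induced G e) f independent rest
      (colourable-induced k rest-bound (e ∘ Enumeration.elem rest))
    where
    open ≤-Reasoning
    rest : Enumeration (¬_ ∘ Image f)
    rest = enumerate (¬? ∘ image? f)
    open Enumeration rest using (size; elem-injective; elem-sound)
    rest-bound : size < R + k * n
    rest-bound = +-cancelˡ-< n size (R + k * n) (begin-strict
      n + size          ≤⟨ disjoint-injections⇒+≤ f-injective elem-injective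
                             (λ i w eq → elem-sound w (i , eq)) ⟩
      M                 <⟨ M<bound ⟩
      R + (n + k * n)   ≡⟨ x∙yz≈y∙xz R n (k * n) ⟩
      n + (R + k * n)   ∎)

m≤⌈m/n⌉*n : ∀ a m → a ≤ ⌈ a / suc m ⌉ * suc m
m≤⌈m/n⌉*n a m = +-cancelʳ-≤ m a q (begin
  a + m                   ≡⟨ m≡m%n+[m/n]*n (a + m) (suc m) ⟩
  (a + m) % suc m + q     ≤⟨ +-monoˡ-≤ q (s≤s⁻¹ (m%n<n (a + m) (suc m))) ⟩
  m + q                   ≡⟨ +-comm m q ⟩
  q + m                   ∎)
  where
  open ≤-Reasoning
  q = ⌈ a / suc m ⌉ * suc m

m<n+⌈[m∸n+1]/o⌉*o : ∀ {N R} m → R ≤ N → N < R + ⌈ (N ∸ R + 1) / suc m ⌉ * suc m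
m<n+⌈[m∸n+1]/o⌉*o {N} {R} m R≤N = begin-strict
  N                 <⟨ n<1+n N ⟩
  suc N             ≡⟨ cong suc (m+[n∸m]≡n R≤N) ⟨
  suc (R + (N ∸ R)) ≡⟨ +-suc R (N ∸ R) ⟨
  R + suc (N ∸ R)   ≡⟨ cong (R +_) (+-comm 1 (N ∸ R)) ⟩
  R + (N ∸ R + 1)   ≤⟨ +-monoʳ-≤ R (m≤⌈m/n⌉*n (N ∸ R + 1) m) ⟩
  R + ⌈ (N ∸ R + 1) / suc m ⌉ * suc m ∎
  where open ≤-Reasoning

mainTheorem4 : (n : ℕ) → 2 < n →
    (R : ℕ) → IsDiagonalRamsey n R →
    (g : ℕ) → IsMaxChromaticBelow n R g →
    (N : ℕ) (G : Graph N) → CliqueNumberLessThan G n → R ≤ N →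
    (χ : ℕ) → IsChromaticNumber G χ →
    χ ≤ ⌈ (N ∸ R + 1) / n ⌉ + g
mainTheorem4 (suc m) _ R (ramsey , _) g (_ , maxChromatic) N G noClique R≤N χ (_ , χ-least) =
  χ-least (k + g) (colourable-induced ramsey G noClique colourable-small k (m<n+⌈[m∸n+1]/o⌉*o m R≤N) id)
  where
  k : ℕ
  k = ⌈ (N ∸ R + 1) / suc m ⌉
  colourable-small : ∀ {M} → M < R → (e : Fin M → Fin N) → Colourable (induced G e) g
  colourable-small {M} M<R e with chromaticNumber-exists (induced G e)
  ... | c , isChromatic@(colourable , _) =
    colourable-mono (induced G e)
      (maxChromatic M M<R (induced G e) (induced-noClique G e noClique) c isChromatic) colourable
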